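{- For all integers $a,b,c\geq 2$, the triangular tower graph ${TT}_{a,b,c}$ is claw-contractible-free and claw-free. In particular, for $n\geq 3$ the graph ${TT}_{n,n,n}$ is claw-contractible-free and claw-free.
   Context: All graphs are finite and simple. The claw is $K_{1,3}$. A graph is claw-free if it has no induced subgraph isomorphic to the claw. A graph $G$ contracts to the claw if there is a subset $S$ of its edges such that contracting the edges of $S$ and replacing multiple edges by single edges yields the claw; $G$ is claw-contractible-free if it does not contract to the claw. For $a,b,c\geq 2$, the triangular tower graph ${TT}_{a,b,c}$ is the graph on vertices $v_1,\dots,v_{a+b+c}$ with edges $v_iv_{i+1}$ for $i\in\{1,\dots,a-1\}\cup\{a+1,\dots,a+b-1\}\cup\{a+b+1,\dots,a+b+c-1\}$, together with $v_1v_{a+1}$, $v_{a+1}v_{a+b+1}$, $v_{a+b+1}v_1$ and $v_av_{a+b}$, $v_{a+b}v_{a+b+c}$, $v_{a+b+c}v_a$. -}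

module Defs where

open import Level using (Level; 0ℓ) renaming (suc to lsuc)
open import Data.Nat using (ℕ; zero; suc; _+_; _≤_)
open import Data.Fin using (Fin; toℕ)
open import Data.Product using (Σ; ∃; _×_; _,_)
open import Data.Sum using (_⊎_)
open import Relation.Nullary using (¬_)
open import Relation.Binary.PropositionalEquality using (_≡_; _≢_)
open import Function.Bundles using (_⇔_)
open import Function.Definitions using (Injective; Surjective)

-- A finite graph on vertex set Fin n with an adjacency relation.
-- (Simplicity -- symmetry, irreflexivity -- holds for the concrete graphs used.)
record Graph : Set₁ where
  field
    n   : ℕ
    Adj : Fin n → Fin n → Set
open Graph public

data ClawAdj : Fin 4 → Fin 4 → Set where
  out : ∀ {j} → j ≢ Fin.zero → ClawAdj Fin.zero j
  inn : ∀ {i} → i ≢ Fin.zero → ClawAdj i Fin.zero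

Claw : Graph
Claw = record { n = 4 ; Adj = ClawAdj }

InducedSubgraph : Graph → Graph → Set
InducedSubgraph H G =
  Σ (Fin (n H) → Fin (n G)) λ f →
    Injective _≡_ _≡_ f ×
    (∀ i j → Adj G (f i) (f j) ⇔ Adj H i j)

ClawFree : Graph → Set
ClawFree G = ¬ InducedSubgraph Claw G

-- Contracting an edge set S identifies the vertices of each
-- connected component of the spanning subgraph (V(G), S); two distinct
-- resulting vertices are adjacent iff some edge of G joins the
-- corresponding components (loops and multiple edges discarded).

data Reach {m : ℕ} (S : Fin m → Fin m → Set) : Fin m → Fin m → Set where
  here  : ∀ {u} → Reach S u u
  fwd   : ∀ {u w v} → S u w → Reach S w v → Reach S u v
  bwd   : ∀ {u w v} → S w u → Reach S w v → Reach S u v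

-- G contracts to H: there is an edge subset S of G and a bijection between
-- the components of (V(G),S) and V(H) (given by φ : V(G) → V(H),
-- surjective, with fibres exactly the components) which is an isomorphism
-- between the contracted graph and H.
ContractsTo : Graph → Graph → Set₁
ContractsTo G H =
  Σ (Fin (n G) → Fin (n G) → Set) λ S →
    (∀ u v → S u v → Adj G u v) ×
    Σ (Fin (n G) → Fin (n H)) λ φ →
      (∀ u v → (φ u ≡ φ v) ⇔ Reach S u v) ×
      Surjective _≡_ _≡_ φ ×
      (∀ i j → i ≢ j →
         (Adj H i j ⇔ (∃ λ u → ∃ λ v → φ u ≡ i × φ v ≡ j × Adj G u v)))

ClawContractibleFree : Graph → Set₁
ClawContractibleFree G = ¬ ContractsTo G Claw

-- Triangular tower TT_{a,b,c}: vertices v_1 .. v_{a+b+c}; vertex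
-- x : Fin (a+b+c) is v_{toℕ x + 1}.

data TTEdge (a b c : ℕ) : ℕ → ℕ → Set where
  path₁ : ∀ i → 1 ≤ i → suc i ≤ a → TTEdge a b c i (suc i)
  path₂ : ∀ i → suc a ≤ i → suc i ≤ a + b → TTEdge a b c i (suc i)
  path₃ : ∀ i → suc (a + b) ≤ i → suc i ≤ a + b + c → TTEdge a b c i (suc i)
  top₁  : TTEdge a b c 1 (suc a)
  top₂  : TTEdge a b c (suc a) (suc (a + b))
  top₃  : TTEdge a b c (suc (a + b)) 1
  bot₁  : TTEdge a b c a (a + b)
  bot₂  : TTEdge a b c (a + b) (a + b + c)
  bot₃  : TTEdge a b c (a + b + c) a

TT : ℕ → ℕ → ℕ → Graph
TT a b c = record
  { n   = a + b + c
  ; Adj = λ x y → TTEdge a b c (suc (toℕ x)) (suc (toℕ y))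
                ⊎ TTEdge a b c (suc (toℕ y)) (suc (toℕ x))
  }

-- Claw-freeness: the neighbours of a vertex split into those towards the top triangle (its
-- predecessor on its path, or the other two top corners) and those towards the bottom one, and
-- each part is a clique; so two of any three neighbours coincide or are adjacent.
--
-- Contraction: contracting onto the claw labels the vertices by the vertices of the claw so that
-- the centre fibre is connected and adjacent non-centre vertices share their label.  Two
-- non-centre vertices on one path share their label: otherwise the centre fibre meets the segment
-- strictly between them and also the rest of the cycle formed by that path, the next path and the
-- two triangles, yet it cannot pass the two endpoints.  So the three leaf labels live on three
-- different paths, and non-centre vertices chosen on them cut the tower into a top and a bottom
-- part; the centre fibre meets both parts (or two leaf labels agree) but cannot cross the cut.

module Submission where

open import Defs
open import Data.Empty using (⊥; ⊥-elim)
open import Data.Fin using (Fin; zero; suc; toℕ; fromℕ<; punchOut)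
open import Data.Fin.Properties
  using (_≟_; 0≢1+n; suc-injective; toℕ-injective; toℕ<n; toℕ-fromℕ<; punchOut-injective)
open import Data.Nat
  using (ℕ; zero; suc; _+_; _∸_; _≤_; _<_; _≤′_; ≤′-reflexive; ≤′-step; z≤n; s≤s; z<s; _<?_)
open import Data.Nat.Properties
  using ( ≤-refl; ≤-trans; <-trans; ≤-<-trans; <-≤-trans; <⇒≤; <⇒≱; ≤-pred; ≤∧≢⇒<
        ; <-irrefl; <-asym; <-cmp
        ; m≤m+n; +-monoʳ-≤; +-monoʳ-<; +-suc; +-identityʳ; +-cancelˡ-≡; +-cancelˡ-≤
        ; m<n⇒m<1+n; m≤n⇒m≤1+n; n≤1+n; n<1+n; ≮⇒≥; m+[n∸m]≡n; m<n+o⇒m∸n<o; m≤n⇒∃[o]m+o≡n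
        ; ≤⇒≤′; ≤′⇒≤ )
  renaming (suc-injective to ℕ-suc-injective)
open import Data.Product using (Σ; ∃; ∃₂; _×_; _,_; proj₁; proj₂)
open import Data.Sum using (_⊎_; inj₁; inj₂; swap; map₁; [_,_]′)
open import Function using (_∘_)
open import Function.Bundles using (Equivalence; _⇔_)
open import Relation.Binary.Definitions using (tri<; tri≈; tri>)
open import Relation.Binary.PropositionalEquality
open import Relation.Nullary using (¬_; yes; no)

SomePair : {A : Set} → (A → A → Set) → A → A → A → Set
SomePair R x y z = R x y ⊎ R x z ⊎ R y z

fin2-pair : (x y z : Fin 2) → SomePair _≡_ x y z
fin2-pair zero       zero       _          = inj₁ refl
fin2-pair (suc zero) (suc zero) _          = inj₁ refl
fin2-pair zero       (suc zero) zero       = inj₂ (inj₁ refl)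
fin2-pair zero       (suc zero) (suc zero) = inj₂ (inj₂ refl)
fin2-pair (suc zero) zero       zero       = inj₂ (inj₂ refl)
fin2-pair (suc zero) zero       (suc zero) = inj₂ (inj₁ refl)

-- A fourth element of Fin 3 would make punchOut squeeze three distinct elements into Fin 2.
fin3-cover : ∀ {i₁ i₂ i₃ : Fin 3} → i₁ ≢ i₂ → i₁ ≢ i₃ → i₂ ≢ i₃ →
             ∀ j → j ≡ i₁ ⊎ j ≡ i₂ ⊎ j ≡ i₃
fin3-cover {i₁} {i₂} {i₃} d₁₂ d₁₃ d₂₃ j with j ≟ i₁ | j ≟ i₂ | j ≟ i₃
... | yes e | _     | _     = inj₁ e
... | no _  | yes e | _     = inj₂ (inj₁ e)
... | no _  | no _  | yes e = inj₂ (inj₂ e)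
... | no n₁ | no n₂ | no n₃ with fin2-pair (punchOut n₁) (punchOut n₂) (punchOut n₃)
...   | inj₁ e        = ⊥-elim (d₁₂ (punchOut-injective n₁ n₂ e))
...   | inj₂ (inj₁ e) = ⊥-elim (d₁₃ (punchOut-injective n₁ n₃ e))
...   | inj₂ (inj₂ e) = ⊥-elim (d₂₃ (punchOut-injective n₂ n₃ e))

next : Fin 3 → Fin 3
next zero             = suc zero
next (suc zero)       = suc (suc zero)
next (suc (suc zero)) = zero

next-≢ : ∀ i → next i ≢ i
next-≢ zero             ()
next-≢ (suc zero)       ()
next-≢ (suc (suc zero)) ()

≢⇒next : ∀ {i j : Fin 3} → i ≢ j → j ≡ next i ⊎ i ≡ next j
≢⇒next {zero}             {zero}             i≢j = ⊥-elim (i≢j refl)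
≢⇒next {zero}             {suc zero}         _   = inj₁ refl
≢⇒next {zero}             {suc (suc zero)}   _   = inj₂ refl
≢⇒next {suc zero}         {zero}             _   = inj₂ refl
≢⇒next {suc zero}         {suc zero}         i≢j = ⊥-elim (i≢j refl)
≢⇒next {suc zero}         {suc (suc zero)}   _   = inj₁ refl
≢⇒next {suc (suc zero)}   {zero}             _   = inj₁ refl
≢⇒next {suc (suc zero)}   {suc zero}         _   = inj₂ refl
≢⇒next {suc (suc zero)}   {suc (suc zero)}   i≢j = ⊥-elim (i≢j refl)

data Side : Set where
  upper lower : Side

side-pair : (s t u : Side) → SomePair _≡_ s t u
side-pair upper upper _     = inj₁ refl
side-pair lower lower _     = inj₁ refl
side-pair upper lower upper = inj₂ (inj₁ refl)
side-pair upper lower lower = inj₂ (inj₂ refl)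
side-pair lower upper upper = inj₂ (inj₂ refl)
side-pair lower upper lower = inj₂ (inj₁ refl)

claw-edge-meets-centre : ∀ {i j} → ClawAdj i j → i ≡ zero ⊎ j ≡ zero
claw-edge-meets-centre (out _) = inj₁ refl
claw-edge-meets-centre (inn _) = inj₂ refl

Close : (G : Graph) → Fin (n G) → Fin (n G) → Set
Close G y y′ = y ≡ y′ ⊎ Adj G y y′

claw-free-if-neighbours-close :
  (G : Graph) →
  (∀ {x y₁ y₂ y₃} → Adj G x y₁ → Adj G x y₂ → Adj G x y₃ → SomePair (Close G) y₁ y₂ y₃) →
  ClawFree G
claw-free-if-neighbours-close G close (f , f-injective , f-adj) =
  [ far zero l₁ (λ ()) , [ far zero l₂ (λ ()) , far l₁ l₂ (λ ()) ]′ ]′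
    (close (centre-adj zero) (centre-adj l₁) (centre-adj l₂))
  where
  l₁ l₂ : Fin 3
  l₁ = suc zero
  l₂ = suc (suc zero)

  centre-adj : ∀ r → Adj G (f zero) (f (suc r))
  centre-adj r = Equivalence.from (f-adj zero (suc r)) (out (0≢1+n ∘ sym))

  far : ∀ p q → p ≢ q → ¬ Close G (f (suc p)) (f (suc q))
  far p q p≢q (inj₁ e)   = p≢q (suc-injective (f-injective e))
  far p q _   (inj₂ adj) =
    [ (λ ()) , (λ ()) ]′ (claw-edge-meets-centre (Equivalence.to (f-adj (suc p) (suc q)) adj))

module ClawContraction
  (G : Graph) (adj-sym : ∀ {x y} → Adj G x y → Adj G y x)
  (S : Fin (n G) → Fin (n G) → Set) (S⊆Adj : ∀ u v → S u v → Adj G u v)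
  (φ : Fin (n G) → Fin 4) (fibres : ∀ u v → (φ u ≡ φ v) ⇔ Reach S u v)
  (quotient-adj : ∀ i j → i ≢ j →
     (ClawAdj i j ⇔ (∃ λ u → ∃ λ v → φ u ≡ i × φ v ≡ j × Adj G u v)))
  where

  V : Set
  V = Fin (n G)

  Leaf : V → Set
  Leaf x = φ x ≢ zero

  leaf-edge : ∀ {x y} → Adj G x y → Leaf x → Leaf y → φ x ≡ φ y
  leaf-edge {x} {y} xy x-leaf y-leaf with φ x ≟ φ y
  ... | yes eq = eq
  ... | no neq = ⊥-elim ([ x-leaf , y-leaf ]′ (claw-edge-meets-centre
                   (Equivalence.from (quotient-adj (φ x) (φ y) neq) (x , y , refl , refl , xy))))

  Closed : (V → Set) → Set
  Closed P = ∀ {x y} → P x → Adj G x y → φ y ≡ zero → P y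

  CentreIn : (V → Set) → Set
  CentreIn P = ∃ λ o → P o × φ o ≡ zero

  reach-centre : ∀ {u v} → Reach S u v → φ u ≡ zero → φ v ≡ zero
  reach-centre {u} {v} r cu = trans (sym (Equivalence.from (fibres u v) r)) cu

  centre-confined : ∀ {P} → Closed P → ∀ {u v} → φ u ≡ zero → φ v ≡ zero → P u → P v
  centre-confined {P} closed {u} {v} cu cv =
    along (Equivalence.to (fibres u v) (trans cu (sym cv))) cu
    where
    along : ∀ {w v} → Reach S w v → φ w ≡ zero → P w → P v
    along here      _  pw = pw
    along (fwd s r) cw pw = along r cw′ (closed pw (S⊆Adj _ _ s) cw′)
      where
      cw′ : φ _ ≡ zero
      cw′ = reach-centre (fwd s here) cw
    along (bwd s r) cw pw = along r cw′ (closed pw (adj-sym (S⊆Adj _ _ s)) cw′)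
      where
      cw′ : φ _ ≡ zero
      cw′ = reach-centre (bwd s here) cw

  centre-split : ∀ {P Q} → Closed P → (∀ {x} → P x → Q x → ⊥) → CentreIn P → CentreIn Q → ⊥
  centre-split closed disjoint (o , po , co) (o′ , qo′ , co′) =
    disjoint (centre-confined closed co co′ po) qo′

  Linked : (V → Set) → V → V → Set
  Linked P x y = CentreIn P ⊎ φ x ≡ φ y

  linked-sym : ∀ {P x y} → Linked P x y → Linked P y x
  linked-sym (inj₁ c)  = inj₁ c
  linked-sym (inj₂ eq) = inj₂ (sym eq)

  linked-trans : ∀ {P x y z} → Linked P x y → Linked P y z → Linked P x z
  linked-trans (inj₁ c)  _         = inj₁ c
  linked-trans (inj₂ _)  (inj₁ c)  = inj₁ c
  linked-trans (inj₂ xy) (inj₂ yz) = inj₂ (trans xy yz)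

  edge-linked : ∀ {P x y} → P x → P y → Adj G x y → Linked P x y
  edge-linked {x = x} {y} px py xy with φ x ≟ zero | φ y ≟ zero
  ... | yes cx | _      = inj₁ (x , px , cx)
  ... | no _   | yes cy = inj₁ (y , py , cy)
  ... | no lx  | no ly  = inj₂ (leaf-edge xy lx ly)

  walk-linked : ∀ {P} (f : ℕ → V) {k k′} → k ≤ k′ →
                (∀ {m} → m < k′ → Adj G (f m) (f (suc m))) →
                (∀ {m} → k ≤ m → m ≤ k′ → P (f m)) →
                Linked P (f k) (f k′)
  walk-linked {P} f {k} k≤k′ = go (≤⇒≤′ k≤k′)
    where
    go : ∀ {k′} → k ≤′ k′ →
         (∀ {m} → m < k′ → Adj G (f m) (f (suc m))) →
         (∀ {m} → k ≤ m → m ≤ k′ → P (f m)) →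
         Linked P (f k) (f k′)
    go (≤′-reflexive refl) _ _ = inj₂ refl
    go {suc j} (≤′-step k≤′j) step inP =
      linked-trans (go k≤′j (step ∘ m<n⇒m<1+n) (λ k≤m m≤j → inP k≤m (m≤n⇒m≤1+n m≤j)))
                   (edge-linked (inP k≤j (n≤1+n j)) (inP (m≤n⇒m≤1+n k≤j) ≤-refl) (step ≤-refl))
      where
      k≤j : k ≤ j
      k≤j = ≤′⇒≤ k≤′j

m<n⇒m≢n+o : ∀ {m n o} → m < n → m ≢ n + o
m<n⇒m≢n+o {o = o} m<n refl = <⇒≱ m<n (m≤m+n _ o)

+-suc-suc : ∀ m n → m + suc (suc n) ≡ suc (suc (m + n))
+-suc-suc m n = trans (+-suc m (suc n)) (cong suc (+-suc m n))

module Tower (a′ b′ c′ : ℕ) where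

  a b c N : ℕ
  a = suc a′
  b = suc b′
  c = suc c′
  N = a + b + c

  G : Graph
  G = TT a b c

  -- TT a b c consists of the paths v₁…v_a, v_{a+1}…v_{a+b}, v_{a+b+1}…v_{a+b+c}; position k of
  -- path i is the vertex v_{index i k}.  Position 0 lies on the top triangle, position last i on
  -- the bottom one.
  last : Fin 3 → ℕ
  last zero             = a′
  last (suc zero)       = b′
  last (suc (suc zero)) = c′

  len : Fin 3 → ℕ
  len i = suc (last i)

  offset : Fin 3 → ℕ
  offset zero             = 0
  offset (suc zero)       = a
  offset (suc (suc zero)) = a + b

  index : Fin 3 → ℕ → ℕ
  index i k = suc (offset i + k)

  At : Fin N → Fin 3 → ℕ → Set
  At x i k = toℕ x ≡ offset i + k × k < len i

  position-injective : ∀ {i j k l} → k < len i → l < len j → offset i + k ≡ offset j + l →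
                       i ≡ j × k ≡ l
  position-injective {zero}           {zero}           _   _   e = refl , e
  position-injective {suc zero}       {suc zero}       _   _   e = refl , +-cancelˡ-≡ a _ _ e
  position-injective {suc (suc zero)} {suc (suc zero)} _   _   e = refl , +-cancelˡ-≡ (a + b) _ _ e
  position-injective {zero}           {suc zero}       k<a _   e = ⊥-elim (m<n⇒m≢n+o k<a e)
  position-injective {zero}           {suc (suc zero)} k<a _   e =
    ⊥-elim (m<n⇒m≢n+o (<-≤-trans k<a (m≤m+n a b)) e)
  position-injective {suc zero}       {suc (suc zero)} k<b _   e =
    ⊥-elim (m<n⇒m≢n+o (+-monoʳ-< a k<b) e)
  position-injective {suc zero}       {zero}           _   l<a e = ⊥-elim (m<n⇒m≢n+o l<a (sym e))
  position-injective {suc (suc zero)} {zero}           _   l<a e =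
    ⊥-elim (m<n⇒m≢n+o (<-≤-trans l<a (m≤m+n a b)) (sym e))
  position-injective {suc (suc zero)} {suc zero}       _   l<b e =
    ⊥-elim (m<n⇒m≢n+o (+-monoʳ-< a l<b) (sym e))

  at-coordinates : ∀ {x i j k l} → At x i k → At x j l → i ≡ j × k ≡ l
  at-coordinates (e , k<len) (e′ , l<len) = position-injective k<len l<len (trans (sym e) e′)

  at-injective : ∀ {x y i k} → At x i k → At y i k → x ≡ y
  at-injective (e , _) (e′ , _) = toℕ-injective (trans e (sym e′))

  locate : (x : Fin N) → ∃₂ λ i k → At x i k
  locate x with toℕ x <? a
  ... | yes x<a = zero , toℕ x , refl , x<a
  ... | no x≮a with toℕ x <? a + b
  ...   | yes x<a+b =
    suc zero , toℕ x ∸ a , sym (m+[n∸m]≡n (≮⇒≥ x≮a)) , m<n+o⇒m∸n<o (toℕ x) a x<a+b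
  ...   | no x≮a+b =
    suc (suc zero) , toℕ x ∸ (a + b) , sym (m+[n∸m]≡n (≮⇒≥ x≮a+b)) ,
    m<n+o⇒m∸n<o (toℕ x) (a + b) (toℕ<n x)

  position<N : ∀ {i k} → k < len i → offset i + k < N
  position<N {zero}           k<a = <-≤-trans k<a (≤-trans (m≤m+n a b) (m≤m+n (a + b) c))
  position<N {suc zero}       k<b = <-≤-trans (+-monoʳ-< a k<b) (m≤m+n (a + b) c)
  position<N {suc (suc zero)} k<c = +-monoʳ-< (a + b) k<c

  -- Off the path (k ≥ len i) the junk value zero is returned; every use supplies k < len i.
  vertex : Fin 3 → ℕ → Fin N
  vertex i k with k <? len i
  ... | yes k<len = fromℕ< (position<N k<len)
  ... | no _      = zero

  vertex-at : ∀ {i k} → k < len i → At (vertex i k) i k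
  vertex-at {i} {k} k<len with k <? len i
  ... | yes p     = toℕ-fromℕ< (position<N p) , k<len
  ... | no  k≮len = ⊥-elim (k≮len k<len)

  at⇒vertex : ∀ {x i k} → At x i k → x ≡ vertex i k
  at⇒vertex at = at-injective at (vertex-at (proj₂ at))

  vertex-index : ∀ {i k} → k < len i → suc (toℕ (vertex i k)) ≡ index i k
  vertex-index k<len = cong suc (proj₁ (vertex-at k<len))

  index-suc : ∀ i k → index i (suc k) ≡ suc (index i k)
  index-suc i k = cong suc (+-suc (offset i) k)

  index-first : ∀ i → index i 0 ≡ suc (offset i)
  index-first i = cong suc (+-identityʳ (offset i))

  index-last : ∀ i → index i (last i) ≡ offset i + len i
  index-last i = sym (+-suc (offset i) (last i))

  -- An edge from position k of path i to position l of path j; the side says whether it leads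
  -- towards the top triangle or towards the bottom one.
  data Link : Side → Fin 3 → ℕ → Fin 3 → ℕ → Set where
    down   : ∀ {i k} → Link lower i k i (suc k)
    up     : ∀ {i k} → Link upper i (suc k) i k
    top    : ∀ {i j} → i ≢ j → Link upper i 0 j 0
    bottom : ∀ {i j k l} → i ≢ j → k ≡ last i → l ≡ last j → Link lower i k j l

  link-reverse : ∀ {s i k j l} → Link s i k j l → ∃ λ s′ → Link s′ j l i k
  link-reverse down                 = upper , up
  link-reverse up                   = lower , down
  link-reverse (top i≢j)            = upper , top (≢-sym i≢j)
  link-reverse (bottom i≢j eqk eql) = lower , bottom (≢-sym i≢j) eql eqk

  along-edge : ∀ i {k} → suc k < len i → TTEdge a b c (index i k) (suc (index i k))
  along-edge zero             k<a = path₁ _ (s≤s z≤n) k<a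
  along-edge (suc zero)       {k} k<b =
    path₂ _ (s≤s (m≤m+n a k)) (subst (_≤ a + b) (+-suc-suc a k) (+-monoʳ-≤ a k<b))
  along-edge (suc (suc zero)) {k} k<c =
    path₃ _ (s≤s (m≤m+n (a + b) k)) (subst (_≤ N) (+-suc-suc (a + b) k) (+-monoʳ-≤ (a + b) k<c))

  top-edge : ∀ i → TTEdge a b c (suc (offset i)) (suc (offset (next i)))
  top-edge zero             = top₁
  top-edge (suc zero)       = top₂
  top-edge (suc (suc zero)) = top₃

  bottom-edge : ∀ i → TTEdge a b c (offset i + len i) (offset (next i) + len (next i))
  bottom-edge zero             = bot₁
  bottom-edge (suc zero)       = bot₂
  bottom-edge (suc (suc zero)) = bot₃

  path-edge-tail : ∀ i {n} → suc (offset i) ≤ n → suc n ≤ offset i + len i →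
                   ∃ λ k → n ≡ index i k × suc k < len i
  path-edge-tail i p q with m≤n⇒∃[o]m+o≡n p
  ... | k , refl =
    k , refl ,
    +-cancelˡ-≤ (offset i) _ _ (subst (_≤ offset i + len i) (sym (+-suc-suc (offset i) k)) q)

  relocate : ∀ {s i₀ k₀ j₀ l₀ i k j l} → Link s i₀ k₀ j₀ l₀ →
             k₀ < len i₀ → l₀ < len j₀ → k < len i → l < len j →
             index i₀ k₀ ≡ index i k → index j₀ l₀ ≡ index j l → Link s i k j l
  relocate lnk p₀ q₀ p q e f
    with position-injective p₀ p (ℕ-suc-injective e) | position-injective q₀ q (ℕ-suc-injective f)
  ... | refl , refl | refl , refl = lnk

  module _ {i k j l} (k<len : k < len i) (l<len : l < len j) where

    along-link : ∀ i₀ {n} → suc (offset i₀) ≤ n → suc n ≤ offset i₀ + len i₀ →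
                 n ≡ index i k → suc n ≡ index j l → ∃ λ s → Link s i k j l
    along-link i₀ p q eX eY with path-edge-tail i₀ p q
    ... | k₀ , refl , k₀<last =
      lower , relocate down (<⇒≤ k₀<last) k₀<last k<len l<len eX (trans (index-suc i₀ k₀) eY)

    top-link : ∀ i₀ → suc (offset i₀) ≡ index i k → suc (offset (next i₀)) ≡ index j l →
               ∃ λ s → Link s i k j l
    top-link i₀ eX eY =
      upper , relocate (top (≢-sym (next-≢ i₀))) z<s z<s k<len l<len
                (trans (index-first i₀) eX) (trans (index-first (next i₀)) eY)

    bottom-link : ∀ i₀ → offset i₀ + len i₀ ≡ index i k →
                  offset (next i₀) + len (next i₀) ≡ index j l → ∃ λ s → Link s i k j l
    bottom-link i₀ eX eY =
      lower , relocate (bottom (≢-sym (next-≢ i₀)) refl refl) ≤-refl ≤-refl k<len l<len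
                (trans (index-last i₀) eX) (trans (index-last (next i₀)) eY)

  edge⇒link : ∀ {X Y i k j l} → TTEdge a b c X Y → X ≡ index i k → Y ≡ index j l →
              k < len i → l < len j → ∃ λ s → Link s i k j l
  edge⇒link (path₁ _ p q) eX eY k<len l<len = along-link k<len l<len zero p q eX eY
  edge⇒link (path₂ _ p q) eX eY k<len l<len = along-link k<len l<len (suc zero) p q eX eY
  edge⇒link (path₃ _ p q) eX eY k<len l<len = along-link k<len l<len (suc (suc zero)) p q eX eY
  edge⇒link top₁          eX eY k<len l<len = top-link k<len l<len zero eX eY
  edge⇒link top₂          eX eY k<len l<len = top-link k<len l<len (suc zero) eX eY
  edge⇒link top₃          eX eY k<len l<len = top-link k<len l<len (suc (suc zero)) eX eY
  edge⇒link bot₁          eX eY k<len l<len = bottom-link k<len l<len zero eX eY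
  edge⇒link bot₂          eX eY k<len l<len = bottom-link k<len l<len (suc zero) eX eY
  edge⇒link bot₃          eX eY k<len l<len = bottom-link k<len l<len (suc (suc zero)) eX eY

  adj⇒link : ∀ {x y i k j l} → Adj G x y → At x i k → At y j l → ∃ λ s → Link s i k j l
  adj⇒link (inj₁ e) (ex , p) (ey , q) = edge⇒link e (cong suc ex) (cong suc ey) p q
  adj⇒link (inj₂ e) (ex , p) (ey , q) =
    link-reverse (proj₂ (edge⇒link e (cong suc ey) (cong suc ex) q p))

  adj-between : ∀ {X Y i k j l} → TTEdge a b c X Y ⊎ TTEdge a b c Y X →
                X ≡ index i k → Y ≡ index j l → k < len i → l < len j →
                Adj G (vertex i k) (vertex j l)
  adj-between e eX eY p q =
    subst₂ (λ X Y → TTEdge a b c X Y ⊎ TTEdge a b c Y X)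
           (trans eX (sym (vertex-index p))) (trans eY (sym (vertex-index q))) e

  link⇒adj : ∀ {s i k j l} → Link s i k j l → k < len i → l < len j →
             Adj G (vertex i k) (vertex j l)
  link⇒adj (down {i} {k}) p q = adj-between (inj₁ (along-edge i q)) refl (sym (index-suc i k)) p q
  link⇒adj up             p q = swap (link⇒adj down q p)
  link⇒adj (top {i} {j} i≢j) p q with ≢⇒next i≢j
  ... | inj₁ refl = adj-between (inj₁ (top-edge i)) (sym (index-first i)) (sym (index-first j)) p q
  ... | inj₂ refl = adj-between (inj₂ (top-edge j)) (sym (index-first i)) (sym (index-first j)) p q
  link⇒adj (bottom {i} {j} i≢j refl refl) p q with ≢⇒next i≢j
  ... | inj₁ refl = adj-between (inj₁ (bottom-edge i)) (sym (index-last i)) (sym (index-last j)) p q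
  ... | inj₂ refl = adj-between (inj₂ (bottom-edge j)) (sym (index-last i)) (sym (index-last j)) p q

  along-path : ∀ {i k′ m} → k′ < len i → m < k′ → Adj G (vertex i m) (vertex i (suc m))
  along-path k′<len m<k′ = link⇒adj down (<-trans m<k′ k′<len) (≤-<-trans m<k′ k′<len)

  at-adj : ∀ {s i k j l x y} → Link s i k j l → At x i k → At y j l → Adj G x y
  at-adj lnk x-at y-at =
    subst₂ (Adj G) (sym (at⇒vertex x-at)) (sym (at⇒vertex y-at))
           (link⇒adj lnk (proj₂ x-at) (proj₂ y-at))

  triangle-close : ∀ {s} (f : Fin 3 → ℕ) → (∀ {j j′} → j ≢ j′ → Link s j (f j) j′ (f j′)) →
                   ∀ {j j′ y y′} → At y j (f j) → At y′ j′ (f j′) → Close G y y′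
  triangle-close f link {j} {j′} y-at y′-at with j ≟ j′
  ... | yes refl = inj₁ (at-injective y-at y′-at)
  ... | no j≢j′  = inj₂ (at-adj (link j≢j′) y-at y′-at)

  same-side-close : ∀ {s i k j l j′ l′ y y′} → Link s i k j l → Link s i k j′ l′ →
                    At y j l → At y′ j′ l′ → Close G y y′
  same-side-close down down y-at y′-at = inj₁ (at-injective y-at y′-at)
  same-side-close up   up   y-at y′-at = inj₁ (at-injective y-at y′-at)
  same-side-close (top _) (top _) y-at y′-at = triangle-close (λ _ → 0) top y-at y′-at
  same-side-close (bottom _ refl refl) (bottom _ _ refl) y-at y′-at =
    triangle-close last (λ j≢j′ → bottom j≢j′ refl refl) y-at y′-at
  same-side-close down (bottom _ refl _) (_ , last<last) _ =
    ⊥-elim (<-irrefl refl (≤-pred last<last))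
  same-side-close (bottom _ refl _) down _ (_ , last<last) =
    ⊥-elim (<-irrefl refl (≤-pred last<last))

  neighbours-close : ∀ {x y₁ y₂ y₃} → Adj G x y₁ → Adj G x y₂ → Adj G x y₃ →
                     SomePair (Close G) y₁ y₂ y₃
  neighbours-close {x} {y₁} {y₂} {y₃} xy₁ xy₂ xy₃
    with locate x | locate y₁ | locate y₂ | locate y₃
  ... | _ , _ , x-at | _ , _ , at₁ | _ , _ , at₂ | _ , _ , at₃
    with adj⇒link xy₁ x-at at₁ | adj⇒link xy₂ x-at at₂ | adj⇒link xy₃ x-at at₃
  ... | s₁ , l₁ | s₂ , l₂ | s₃ , l₃ with side-pair s₁ s₂ s₃
  ... | inj₁ refl        = inj₁ (same-side-close l₁ l₂ at₁ at₂)
  ... | inj₂ (inj₁ refl) = inj₂ (inj₁ (same-side-close l₁ l₃ at₁ at₃))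
  ... | inj₂ (inj₂ refl) = inj₂ (inj₂ (same-side-close l₂ l₃ at₂ at₃))

  claw-free : ClawFree G
  claw-free = claw-free-if-neighbours-close G neighbours-close

  module Contraction
    (S : Fin N → Fin N → Set) (S⊆Adj : ∀ u v → S u v → Adj G u v)
    (φ : Fin N → Fin 4) (fibres : ∀ u v → (φ u ≡ φ v) ⇔ Reach S u v)
    (quotient-adj : ∀ i j → i ≢ j →
       (ClawAdj i j ⇔ (∃ λ u → ∃ λ v → φ u ≡ i × φ v ≡ j × Adj G u v)))
    where

    open ClawContraction G swap S S⊆Adj φ fibres quotient-adj

    record LeafSite (i : Fin 3) : Set where
      constructor leaf-site
      field
        pos     : ℕ
        pos<len : pos < len i
        leaf    : Leaf (vertex i pos)
    open LeafSite

    label : ∀ {i} → LeafSite i → Fin 4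
    label {i} s = φ (vertex i (pos s))

    centre-off-leaf : ∀ {i k l} → Leaf (vertex i k) → φ (vertex i l) ≡ zero → l ≢ k
    centre-off-leaf k-leaf c refl = k-leaf c

    Region : (Fin 3 → ℕ → Set) → Fin N → Set
    Region R x = ∃₂ λ i k → At x i k × R i k

    region-vertex : ∀ {R i k} → k < len i → R i k → Region R (vertex i k)
    region-vertex k<len r = _ , _ , vertex-at k<len , r

    regions-disjoint : ∀ {R R′} → (∀ {i k} → R i k → R′ i k → ⊥) →
                       ∀ {x} → Region R x → Region R′ x → ⊥
    regions-disjoint disjoint (_ , _ , at , r) (_ , _ , at′ , r′) with at-coordinates at at′
    ... | refl , refl = disjoint r r′

    region-closed : ∀ {R} →
      (∀ {s i k j l} → Link s i k j l → k < len i → R i k → φ (vertex j l) ≡ zero → R j l) →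
      Closed (Region R)
    region-closed step {y = y} (_ , _ , x-at , r) xy cy with locate y
    ... | _ , _ , y-at =
      _ , _ , y-at ,
      step (proj₂ (adj⇒link xy x-at y-at)) (proj₂ x-at) r (trans (cong φ (sym (at⇒vertex y-at))) cy)

    region-centre-map : ∀ {R R′} → (∀ {i k} → R i k → φ (vertex i k) ≡ zero → R′ i k) →
                        CentreIn (Region R) → CentreIn (Region R′)
    region-centre-map f (o , (_ , _ , at , r) , co) =
      o , (_ , _ , at , f r (trans (cong φ (sym (at⇒vertex at))) co)) , co

    walk-on : ∀ {R} i {k k′} → k ≤ k′ → k′ < len i → (∀ {m} → k ≤ m → m ≤ k′ → R i m) →
              Linked (Region R) (vertex i k) (vertex i k′)
    walk-on i k≤k′ k′<len inR =
      walk-linked (vertex i) k≤k′ (along-path k′<len)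
                  (λ k≤m m≤k′ → region-vertex (≤-<-trans m≤k′ k′<len) (inR k≤m m≤k′))

    link-linked : ∀ {R s i k j l} → Link s i k j l → k < len i → l < len j → R i k → R j l →
                  Linked (Region R) (vertex i k) (vertex j l)
    link-linked lnk p q r r′ =
      edge-linked (region-vertex p r) (region-vertex q r′) (link⇒adj lnk p q)

    Segment Inside Outside : Fin 3 → ℕ → ℕ → Fin 3 → ℕ → Set
    Segment i k k′ j m = j ≡ i × k ≤ m × m ≤ k′
    Inside  i k k′ j m = j ≡ i × k < m × m < k′
    Outside i k k′ j m = ¬ Inside i k k′ j m

    inside-closed : ∀ {i k k′} → k′ < len i → Leaf (vertex i k) → Leaf (vertex i k′) →
                    Closed (Region (Inside i k k′))
    inside-closed {i} {k} {k′} k′<len k-leaf k′-leaf = region-closed step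
      where
      step : ∀ {s j m j′ l} → Link s j m j′ l → m < len j → Inside i k k′ j m →
             φ (vertex j′ l) ≡ zero → Inside i k k′ j′ l
      step down _ (refl , k<m , m<k′) c =
        refl , m<n⇒m<1+n k<m , ≤∧≢⇒< m<k′ (centre-off-leaf k′-leaf c)
      step up   _ (refl , k<m , m<k′) c =
        refl , ≤∧≢⇒< (≤-pred k<m) (≢-sym (centre-off-leaf k-leaf c)) , <-trans (n<1+n _) m<k′
      step (top _)           _ (_ , () , _) _
      step (bottom _ refl _) _ (refl , _ , m<k′) _ =
        ⊥-elim (<-irrefl refl (<-≤-trans m<k′ (≤-pred k′<len)))

    around : ∀ {i k k′} → k ≤ k′ → k′ < len i →
             Linked (Region (Outside i k k′)) (vertex i k) (vertex i k′)
    around {i} {k} {k′} k≤k′ k′<len =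
      linked-trans (linked-sym to-top)
        (linked-trans across-top
          (linked-trans down-next (linked-trans across-bottom (linked-sym to-bottom))))
      where
      j : Fin 3
      j = next i

      off-path : ∀ {m} → Outside i k k′ j m
      off-path (j≡i , _) = next-≢ i j≡i

      above : ∀ {m} → m ≤ k → Outside i k k′ i m
      above m≤k (_ , k<m , _) = <⇒≱ k<m m≤k

      below : ∀ {m} → k′ ≤ m → Outside i k k′ i m
      below k′≤m (_ , _ , m<k′) = <⇒≱ m<k′ k′≤m

      to-top : Linked (Region (Outside i k k′)) (vertex i 0) (vertex i k)
      to-top = walk-on i z≤n (≤-<-trans k≤k′ k′<len) (λ _ m≤k → above m≤k)

      across-top : Linked (Region (Outside i k k′)) (vertex i 0) (vertex j 0)
      across-top = link-linked (top (≢-sym (next-≢ i))) z<s z<s (above z≤n) off-path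

      down-next : Linked (Region (Outside i k k′)) (vertex j 0) (vertex j (last j))
      down-next = walk-on j z≤n ≤-refl (λ _ _ → off-path)

      across-bottom : Linked (Region (Outside i k k′)) (vertex j (last j)) (vertex i (last i))
      across-bottom =
        link-linked (bottom (next-≢ i) refl refl) ≤-refl ≤-refl off-path (below (≤-pred k′<len))

      to-bottom : Linked (Region (Outside i k k′)) (vertex i k′) (vertex i (last i))
      to-bottom = walk-on i (≤-pred k′<len) ≤-refl (λ k′≤m _ → below k′≤m)

    same-path-ordered : ∀ {i k k′} → k < k′ → k′ < len i → Leaf (vertex i k) → Leaf (vertex i k′) →
                        φ (vertex i k) ≡ φ (vertex i k′)
    same-path-ordered {i} {k} {k′} k<k′ k′<len k-leaf k′-leaf
      with walk-on {Segment i k k′} i (<⇒≤ k<k′) k′<len (λ k≤m m≤k′ → refl , k≤m , m≤k′)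
    ... | inj₂ eq = eq
    ... | inj₁ centre-in-segment with around (<⇒≤ k<k′) k′<len
    ...   | inj₂ eq = eq
    ...   | inj₁ centre-outside =
      ⊥-elim (centre-split (inside-closed k′<len k-leaf k′-leaf) (regions-disjoint (λ r r′ → r′ r))
                (region-centre-map strictly-inside centre-in-segment) centre-outside)
      where
      strictly-inside : ∀ {j m} → Segment i k k′ j m → φ (vertex j m) ≡ zero → Inside i k k′ j m
      strictly-inside (refl , k≤m , m≤k′) c =
        refl , ≤∧≢⇒< k≤m (≢-sym (centre-off-leaf k-leaf c)) , ≤∧≢⇒< m≤k′ (centre-off-leaf k′-leaf c)

    same-path-label : ∀ {i} (s t : LeafSite i) → label s ≡ label t
    same-path-label s t with <-cmp (pos s) (pos t)
    ... | tri< s<t _ _ = same-path-ordered s<t (pos<len t) (leaf s) (leaf t)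
    ... | tri≈ _ s≡t _ = cong (λ k → φ (vertex _ k)) s≡t
    ... | tri> _ _ t<s = sym (same-path-ordered t<s (pos<len s) (leaf t) (leaf s))

    module Cut (site : (j : Fin 3) → LeafSite j) where

      cut : Fin 3 → ℕ
      cut j = pos (site j)

      cut-leaf : ∀ j → Leaf (vertex j (cut j))
      cut-leaf j = leaf (site j)

      cut≤last : ∀ j → cut j ≤ last j
      cut≤last j = ≤-pred (pos<len (site j))

      Above AboveOrAt Below BelowOrAt : Fin 3 → ℕ → Set
      Above     j m = m < cut j
      AboveOrAt j m = m ≤ cut j
      Below     j m = cut j < m
      BelowOrAt j m = cut j ≤ m

      above-closed : Closed (Region Above)
      above-closed = region-closed step
        where
        step : ∀ {s j m j′ l} → Link s j m j′ l → m < len j → Above j m →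
               φ (vertex j′ l) ≡ zero → Above j′ l
        step down              _ m<cut  c = ≤∧≢⇒< m<cut (centre-off-leaf (cut-leaf _) c)
        step up                _ sm<cut _ = <-trans (n<1+n _) sm<cut
        step (top _)           _ _      c = ≤∧≢⇒< z≤n (centre-off-leaf (cut-leaf _) c)
        step (bottom _ refl _) _ m<cut  _ = ⊥-elim (<-irrefl refl (<-≤-trans m<cut (cut≤last _)))

      top-route : ∀ {p q} → p ≢ q → Linked (Region Above) (vertex p (cut p)) (vertex q (cut q))
      top-route {p} {q} p≢q =
        map₁ (region-centre-map strict)
          (linked-trans (linked-sym (walk-on p z≤n (pos<len (site p)) (λ _ m≤cut → m≤cut)))
            (linked-trans (link-linked (top p≢q) z<s z<s z≤n z≤n)
              (walk-on q z≤n (pos<len (site q)) (λ _ m≤cut → m≤cut))))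
        where
        strict : ∀ {j m} → AboveOrAt j m → φ (vertex j m) ≡ zero → Above j m
        strict m≤cut c = ≤∧≢⇒< m≤cut (centre-off-leaf (cut-leaf _) c)

      bottom-route : ∀ {p q} → p ≢ q → Linked (Region Below) (vertex p (cut p)) (vertex q (cut q))
      bottom-route {p} {q} p≢q =
        map₁ (region-centre-map strict)
          (linked-trans (walk-on p (cut≤last p) ≤-refl (λ cut≤m _ → cut≤m))
            (linked-trans
              (link-linked (bottom p≢q refl refl) ≤-refl ≤-refl (cut≤last p) (cut≤last q))
              (linked-sym (walk-on q (cut≤last q) ≤-refl (λ cut≤m _ → cut≤m)))))
        where
        strict : ∀ {j m} → BelowOrAt j m → φ (vertex j m) ≡ zero → Below j m
        strict cut≤m c = ≤∧≢⇒< cut≤m (≢-sym (centre-off-leaf (cut-leaf _) c))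

      cut-label : ∀ p q → label (site p) ≡ label (site q)
      cut-label p q with p ≟ q
      ... | yes refl = refl
      ... | no p≢q with top-route p≢q | bottom-route p≢q
      ...   | inj₂ eq           | _                 = eq
      ...   | _                 | inj₂ eq           = eq
      ...   | inj₁ centre-above | inj₁ centre-below =
        ⊥-elim (centre-split above-closed (regions-disjoint <-asym) centre-above centre-below)

    three-leaves : ∀ {i₁ i₂ i₃} (s₁ : LeafSite i₁) (s₂ : LeafSite i₂) (s₃ : LeafSite i₃) →
                   SomePair _≡_ (label s₁) (label s₂) (label s₃)
    three-leaves {i₁} {i₂} {i₃} s₁ s₂ s₃ with i₁ ≟ i₂ | i₁ ≟ i₃ | i₂ ≟ i₃
    ... | yes refl | _        | _        = inj₁ (same-path-label s₁ s₂)
    ... | no _     | yes refl | _        = inj₂ (inj₁ (same-path-label s₁ s₃))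
    ... | no _     | no _     | yes refl = inj₂ (inj₂ (same-path-label s₂ s₃))
    ... | no d₁₂   | no d₁₃   | no d₂₃   =
      inj₁ (trans (same-path-label s₁ (site i₁))
           (trans (Cut.cut-label site i₁ i₂) (same-path-label (site i₂) s₂)))
      where
      site : (j : Fin 3) → LeafSite j
      site j with fin3-cover d₁₂ d₁₃ d₂₃ j
      ... | inj₁ refl        = s₁
      ... | inj₂ (inj₁ refl) = s₂
      ... | inj₂ (inj₂ refl) = s₃

    leaf-site-of : ∀ {x} → Leaf x → ∃ λ i → Σ (LeafSite i) λ s → vertex i (pos s) ≡ x
    leaf-site-of {x} x-leaf with locate x
    ... | i , k , at =
      i , leaf-site k (proj₂ at) (subst Leaf (at⇒vertex at) x-leaf) , sym (at⇒vertex at)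

    leaves-collide : ∀ {x₁ x₂ x₃} → Leaf x₁ → Leaf x₂ → Leaf x₃ → SomePair _≡_ (φ x₁) (φ x₂) (φ x₃)
    leaves-collide x₁-leaf x₂-leaf x₃-leaf
      with leaf-site-of x₁-leaf | leaf-site-of x₂-leaf | leaf-site-of x₃-leaf
    ... | _ , s₁ , refl | _ , s₂ , refl | _ , s₃ , refl = three-leaves s₁ s₂ s₃

  claw-contractible-free : ClawContractibleFree G
  claw-contractible-free (S , S⊆Adj , φ , fibres , onto , quotient-adj) =
    [ distinct zero l₁ (λ ()) , [ distinct zero l₂ (λ ()) , distinct l₁ l₂ (λ ()) ]′ ]′
      (leaves-collide (preimage-leaf zero) (preimage-leaf l₁) (preimage-leaf l₂))
    where
    open Contraction S S⊆Adj φ fibres quotient-adj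

    l₁ l₂ : Fin 3
    l₁ = suc zero
    l₂ = suc (suc zero)

    preimage : Fin 3 → Fin N
    preimage r = proj₁ (onto (suc r))

    φ-preimage : ∀ r → φ (preimage r) ≡ suc r
    φ-preimage r = proj₂ (onto (suc r)) refl

    preimage-leaf : ∀ r → φ (preimage r) ≢ zero
    preimage-leaf r c = 0≢1+n (trans (sym c) (φ-preimage r))

    distinct : ∀ r t → r ≢ t → φ (preimage r) ≢ φ (preimage t)
    distinct r t r≢t e = r≢t (suc-injective (trans (sym (φ-preimage r)) (trans e (φ-preimage t))))

-- The hypotheses serve only to exclude a, b or c being 0.
lemma4p1 : (a b c : ℕ) → 2 ≤ a → 2 ≤ b → 2 ≤ c →
    ClawContractibleFree (TT a b c) × ClawFree (TT a b c)
lemma4p1 (suc a′) (suc b′) (suc c′) _ _ _ =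
  Tower.claw-contractible-free a′ b′ c′ , Tower.claw-free a′ b′ c′
lemma4p1 zero       _          _    () _  _
lemma4p1 (suc _)    zero       _    _  () _
lemma4p1 (suc _)    (suc _)    zero _  _  ()
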